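{- Let $G=(V,E)$ be a directed graph, $k\ge 7$ a fixed integer, and let $\mathcal{C}$ and $G_3$ be constructed from $G$ as described in the context. Suppose $D$ is a connected component of $\mathcal{C}$ whose corresponding vertex in $G_3$ is isolated, and $D$ is not a $2$-cycle. Then $D$ can be transformed (by deleting edges of $D$) into a $k$-path partition $\mathcal{P}$ of the induced subgraph $G[V(D)]$ such that $|E(\mathcal{P})| \ge \frac{2}{3}\,|E(D)|$, where $E(\mathcal{P})$ is the set of edges on the paths of $\mathcal{P}$.
   Context: Graphs are directed without self-loops or multiple edges. A path is a simple directed path (a single vertex is a path); its order is its number of vertices. A $k$-path partition of a graph $H$ is a collection of vertex-disjoint paths of $H$, each of order at most $k$, covering all vertices of $H$. A path-cycle cover of a directed graph $H$ is a spanning subgraph in which every vertex has in-degree at most $1$ and out-degree at most $1$; a maximum path-cycle cover is one with the maximum number of edges. $d^+_{\mathcal{C}}(v)$, $d^-_{\mathcal{C}}(v)$ denote out- and in-degree in $\mathcal{C}$. Construction: (i) compute a maximum path-cycle cover $\mathcal{C}$ of $G$; (ii) while there is an edge $(u,v)\in E(G)\setminus E(\mathcal{C})$ such that $d^+_{\mathcal{C}}(u)=0$ and $v$ lies on a cycle of $\mathcal{C}$ (respectively, $d^-_{\mathcal{C}}(v)=0$ and $u$ lies on a cycle of $\mathcal{C}$), replace the edge of $\mathcal{C}$ entering $v$ (respectively, leaving $u$) by $(u,v)$; call the result $\mathcal{C}$. A $2$-cycle is a cycle component of $\mathcal{C}$ with two vertices. (iii) $G_1=(V,E_1)$ where $E_1$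 is the set of edges $(u,v)\in E(G)\setminus E(\mathcal{C})$ with $u,v$ in different components of $\mathcal{C}$, at least one of which is a $2$-cycle. A subgraph $S$ of $G_1$ saturates a $2$-cycle $D'$ of $\mathcal{C}$ if some edge of $S$ is incident to a vertex of $D'$; the weight of $S$ is the number of $2$-cycles of $\mathcal{C}$ it saturates. (iv) Let $M$ be a maximum-weight path-cycle cover of $G_1$; while some edge of $M$ can be removed without changing the weight of $M$, delete it. (v) $G_2=(V,E(\mathcal{C})\cup E(M))$. (vi) $G_3$ is the undirected graph whose vertices correspond one-to-one to the connected components of $\mathcal{C}$, two vertices being adjacent iff there is an edge of $G_2$ between the corresponding components. A vertex is isolated if it has degree $0$. -}

module Defs where

open import Data.Nat using (ℕ; zero; suc; _+_; _*_; _≤_; _<ᵇ_)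
open import Data.Fin using (Fin; toℕ) renaming (zero to fz; suc to fs)
import Data.Fin as F
open import Data.Bool using (Bool; true; false; _∧_; _∨_; if_then_else_)
open import Data.Product using (Σ; _×_; _,_)
open import Data.Sum using (_⊎_)
open import Data.List using (List; length)
open import Data.List.Relation.Unary.All using (All)
open import Data.List.Relation.Unary.Unique.Propositional using (Unique)
open import Relation.Nullary using (¬_)
open import Relation.Nullary.Decidable using (⌊_⌋)
open import Relation.Binary.PropositionalEquality using (_≡_; _≢_)
open import Relation.Binary.Construct.Closure.ReflexiveTransitive using (Star)

count : ∀ {n} → (Fin n → Bool) → ℕ
count {zero}  f = 0
count {suc n} f = (if f fz then 1 else 0) + count (λ i → f (fs i))

sumF : ∀ {n} → (Fin n → ℕ) → ℕ
sumF {zero}  f = 0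
sumF {suc n} f = f fz + sumF (λ i → f (fs i))

anyB : ∀ {n} → (Fin n → Bool) → Bool
anyB {zero}  f = false
anyB {suc n} f = f fz ∨ anyB (λ i → f (fs i))

eqB : ∀ {n} → Fin n → Fin n → Bool
eqB x y = ⌊ x F.≟ y ⌋

-- Directed graphs on vertex set Fin n, given by a Boolean adjacency
-- function (no multiple edges).  Self-loops are excluded by Irrefl.

BGraph : ℕ → Set
BGraph n = Fin n → Fin n → Bool

Irrefl : ∀ {n} → BGraph n → Set
Irrefl G = ∀ v → G v v ≡ false

Edge : ∀ {n} → BGraph n → Fin n → Fin n → Set
Edge G u v = G u v ≡ true

edgeCount : ∀ {n} → BGraph n → ℕ
edgeCount C = sumF (λ u → count (C u))

outdeg : ∀ {n} → BGraph n → Fin n → ℕ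
outdeg C u = count (C u)

indeg : ∀ {n} → BGraph n → Fin n → ℕ
indeg C v = count (λ u → C u v)

-- weak connectivity (connected components ignore orientation)
data Conn {n} (C : BGraph n) : Fin n → Fin n → Set where
  here : ∀ {u} → Conn C u u
  fwd  : ∀ {u v w} → C u v ≡ true → Conn C v w → Conn C u w
  bwd  : ∀ {u v w} → C v u ≡ true → Conn C v w → Conn C u w

data Walk {n} (C : BGraph n) : Fin n → Fin n → ℕ → Set where
  nil  : ∀ {u} → Walk C u u 0
  cons : ∀ {u v w m} → C u v ≡ true → Walk C v w m → Walk C u w (suc m)

-- v lies on a cycle of C (in a path-cycle cover, a closed directed walk
-- through v of positive length is exactly the cycle containing v)
OnCycle : ∀ {n} → BGraph n → Fin n → Set
OnCycle C v = Σ ℕ (λ m → Walk C v v (suc m))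

Acyclic : ∀ {n} → BGraph n → Set
Acyclic P = ∀ v m → ¬ Walk P v v (suc m)

IsPCC : ∀ {n} → (Fin n → Fin n → Set) → BGraph n → Set
IsPCC {n} H C =
  (∀ u v → C u v ≡ true → H u v) ×
  (∀ v → outdeg C v ≤ 1) × (∀ v → indeg C v ≤ 1)

IsMaxPCC : ∀ {n} → (Fin n → Fin n → Set) → BGraph n → Set
IsMaxPCC H C = IsPCC H C × (∀ C' → IsPCC H C' → edgeCount C' ≤ edgeCount C)

upd : ∀ {n} → BGraph n → Fin n → Fin n → Fin n → Fin n → BGraph n
upd C a b u v x y =
  if eqB x u ∧ eqB y v then true
  else if eqB x a ∧ eqB y b then false
  else C x y

StepC : ∀ {n} → BGraph n → BGraph n → BGraph n → Set
StepC {n} G C C' = Σ (Fin n) λ u → Σ (Fin n) λ v →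
  G u v ≡ true × C u v ≡ false ×
  ( (outdeg C u ≡ 0 × OnCycle C v ×
      Σ (Fin n) (λ w → C w v ≡ true × (∀ x y → C' x y ≡ upd C w v u v x y)))
  ⊎ (indeg C v ≡ 0 × OnCycle C u ×
      Σ (Fin n) (λ w → C u w ≡ true × (∀ x y → C' x y ≡ upd C u w u v x y))) )

-- C is a possible outcome of steps (i)-(ii)
IsConstructedC : ∀ {n} → BGraph n → BGraph n → Set
IsConstructedC G C =
  Σ _ (λ C0 → IsMaxPCC (Edge G) C0 × Star (StepC G) C0 C) ×
  (∀ C' → ¬ StepC G C C')

IsComponent : ∀ {n} → BGraph n → (Fin n → Bool) → Set
IsComponent {n} C D =
  Σ (Fin n) (λ r → D r ≡ true) ×
  (∀ u v → D u ≡ true → (D v ≡ true → Conn C u v) × (Conn C u v → D v ≡ true))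

Is2Cycle : ∀ {n} → BGraph n → (Fin n → Bool) → Set
Is2Cycle {n} C D = Σ (Fin n) λ a → Σ (Fin n) λ b →
  a ≢ b × D a ≡ true × D b ≡ true × C a b ≡ true × C b a ≡ true ×
  (∀ v → D v ≡ true → v ≡ a ⊎ v ≡ b)

InTwoCycle : ∀ {n} → BGraph n → Fin n → Set
InTwoCycle C u = Σ _ λ D → IsComponent C D × D u ≡ true × Is2Cycle C D

G1 : ∀ {n} → BGraph n → BGraph n → Fin n → Fin n → Set
G1 G C u v = G u v ≡ true × C u v ≡ false × ¬ Conn C u v ×
             (InTwoCycle C u ⊎ InTwoCycle C v)

sat : ∀ {n} → BGraph n → Fin n → Fin n → Bool
sat S a b = anyB (λ x → S a x ∨ S x a ∨ S b x ∨ S x b)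

-- weight of S: number of 2-cycles of C saturated by S; each 2-cycle of the
-- path-cycle cover C is counted once via its pair {a,b} with a < b
weight : ∀ {n} → BGraph n → BGraph n → ℕ
weight C S = sumF λ a → count λ b →
  (toℕ a <ᵇ toℕ b) ∧ C a b ∧ C b a ∧ sat S a b

IsMaxWeightPCC : ∀ {n} → BGraph n → (Fin n → Fin n → Set) → BGraph n → Set
IsMaxWeightPCC C H M =
  IsPCC H M × (∀ M' → IsPCC H M' → weight C M' ≤ weight C M)

DelStep : ∀ {n} → BGraph n → BGraph n → BGraph n → Set
DelStep {n} C M M' = Σ (Fin n) λ u → Σ (Fin n) λ v →
  M u v ≡ true ×
  (∀ x y → M' x y ≡ (if eqB x u ∧ eqB y v then false else M x y)) ×
  weight C M' ≡ weight C M

IsConstructedM : ∀ {n} → BGraph n → BGraph n → BGraph n → Set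
IsConstructedM G C M =
  Σ _ (λ M0 → IsMaxWeightPCC C (G1 G C) M0 × Star (DelStep C) M0 M) ×
  (∀ M' → ¬ DelStep C M M')

-- G2 = C ∪ M; the G3-vertex of D is isolated iff no edge of G2 joins a
-- vertex of D to a vertex outside D.

IsolatedInG3 : ∀ {n} → BGraph n → BGraph n → (Fin n → Bool) → Set
IsolatedInG3 C M D = ∀ x y → (C x y ∨ M x y) ≡ true → D x ≡ D y

edgesIn : ∀ {n} → BGraph n → (Fin n → Bool) → BGraph n
edgesIn C D x y = C x y ∧ D x ∧ D y

-- k-path partitions of G[V(D)], given by their edge set P on vertex set D:
-- edges of G inside D, in/out-degree ≤ 1, no cycles (so each weak
-- component is a directed path, singletons included, and all of V(D) is
-- covered), and every component has at most k vertices.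

IsKPathPartition : ∀ {n} → ℕ → BGraph n → (Fin n → Bool) → BGraph n → Set
IsKPathPartition {n} k G D P =
  (∀ u v → P u v ≡ true → G u v ≡ true × D u ≡ true × D v ≡ true) ×
  (∀ v → outdeg P v ≤ 1) × (∀ v → indeg P v ≤ 1) ×
  Acyclic P ×
  (∀ v → D v ≡ true → (xs : List (Fin n)) → Unique xs →
     All (Conn P v) xs → length xs ≤ k)

-- Each exchange step of the construction replaces the only edge entering v (or leaving u)
-- by an edge (u, v) whose other endpoint had no edge in that direction, so C keeps in- and
-- out-degrees at most one and the component D is a directed path, or a cycle with at least
-- three vertices (C has no loops and D is not a 2-cycle).  Listing the vertices of D along
-- the path, or along the cycle opened at one edge, and deleting every seventh edge of that
-- list leaves paths with at most seven vertices; of the L - 1 edges of a path at least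
-- 2(L - 1)/3 survive, and of the L ≥ 3 edges of a cycle at least 2L/3.

module Submission where

open import Data.Bool using (Bool; true; false; _∧_; _∨_; if_then_else_)
open import Data.Bool.Properties using (∨-zeroʳ; ¬-not)
import Data.Bool.Properties as Bool
open import Data.Empty using (⊥-elim)
open import Data.Fin using (Fin) renaming (zero to fz; suc to fs)
import Data.Fin as F
import Data.Fin.Properties as FP
open import Data.List using (List; []; _∷_; length; lookup)
import Data.List.Membership.DecPropositional as DecMembership
open import Data.List.Membership.Propositional using (_∈_; _∉_)
open import Data.List.Membership.Propositional.Properties using (∈-lookup)
open import Data.List.Relation.Unary.All using (All; [])
import Data.List.Relation.Unary.All as All
open import Data.List.Relation.Unary.All.Properties.Core using (¬Any⇒All¬)
open import Data.List.Relation.Unary.Any using (here; there)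
open import Data.List.Relation.Unary.Unique.Propositional using (Unique; []; _∷_)
import Data.List.Relation.Unary.Unique.Propositional as Unique
open import Data.List.Relation.Unary.Unique.Propositional.Properties using (Unique[x∷xs]⇒x∉xs)
open import Data.Nat using (ℕ; zero; suc; _+_; _*_; _∸_; _≤_; _<_; _≤?_; z≤n; s≤s)
open import Data.Nat.Properties
open import Algebra.Properties.CommutativeMonoid.Sum +-0-commutativeMonoid
  using (sum; sum-cong-≗; sum-replicate-zero; ∑-distrib-+; ∑-comm)
open import Data.Nat.Tactic.RingSolver using (solve-∀)
open import Data.Product using (Σ; _×_; _,_; map; proj₁; proj₂)
open import Data.Sum using (_⊎_; inj₁; inj₂; [_,_]′)
open import Function using (flip; _∘_)
open import Relation.Binary.Construct.Closure.ReflexiveTransitive using (Star; ε; _◅_)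
open import Relation.Binary.PropositionalEquality
open import Relation.Nullary using (¬_; Dec; yes; no; ¬?)
open import Relation.Nullary.Decidable using (_×-dec_)

open import Defs

∨-true : ∀ {a b} → a ∨ b ≡ true → a ≡ true ⊎ b ≡ true
∨-true {true}  _ = inj₁ refl
∨-true {false} e = inj₂ e

∨-trueʳ : ∀ a {b} → b ≡ true → a ∨ b ≡ true
∨-trueʳ a refl = ∨-zeroʳ a

∧-true : ∀ {a b} → a ∧ b ≡ true → a ≡ true × b ≡ true
∧-true {a} {b} e = Bool.∧-conicalˡ a b e , Bool.∧-conicalʳ a b e

true≢false : true ≢ false
true≢false ()

eqB-refl : ∀ {n} (x : Fin n) → eqB x x ≡ true
eqB-refl x with x F.≟ x
... | yes _  = refl
... | no x≢x = ⊥-elim (x≢x refl)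

eqB-true : ∀ {n} {x y : Fin n} → eqB x y ≡ true → x ≡ y
eqB-true {x = x} {y} e with x F.≟ y
... | yes x≡y = x≡y

eqB-false⇒≢ : ∀ {n} {x y : Fin n} → eqB x y ≡ false → x ≢ y
eqB-false⇒≢ {x = x} e refl = true≢false (trans (sym (eqB-refl x)) e)

eqB-false : ∀ {n} {x y : Fin n} → x ≢ y → eqB x y ≡ false
eqB-false {x = x} {y} x≢y with x F.≟ y
... | yes x≡y = ⊥-elim (x≢y x≡y)
... | no _    = refl

count-false : ∀ {n} (f : Fin n → Bool) → (∀ i → f i ≡ false) → count f ≡ 0
count-false {zero}  f _ = refl
count-false {suc n} f h rewrite h fz = count-false (λ i → f (fs i)) (λ i → h (fs i))

count-mono : ∀ {n} {f g : Fin n → Bool} → (∀ i → f i ≡ true → g i ≡ true) → count f ≤ count g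
count-mono {zero} h = z≤n
count-mono {suc n} {f} {g} h with f fz in ef | g fz in eg
... | true  | true  = s≤s (count-mono (λ i → h (fs i)))
... | true  | false = ⊥-elim (true≢false (trans (sym (h fz ef)) eg))
... | false | true  = m≤n⇒m≤1+n (count-mono (λ i → h (fs i)))
... | false | false = count-mono (λ i → h (fs i))

count-pos : ∀ {n} (f : Fin n → Bool) {i} → f i ≡ true → 1 ≤ count f
count-pos f {fz}   e rewrite e = s≤s z≤n
count-pos f {fs i} e = ≤-trans (count-pos (λ j → f (fs j)) e) (m≤n+m _ _)

count≡0⇒false : ∀ {n} (f : Fin n → Bool) → count f ≡ 0 → ∀ i → f i ≡ false
count≡0⇒false f c i = ¬-not λ fi → 1+n≰n (≤-trans (count-pos f fi) (≤-reflexive c))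

count≤1⇒unique : ∀ {n} (f : Fin n → Bool) → count f ≤ 1 →
  ∀ {i j} → f i ≡ true → f j ≡ true → i ≡ j
count≤1⇒unique f c {fz}   {fz}   _  _  = refl
count≤1⇒unique f c {fz}   {fs j} fi fj = ⊥-elim (<-irrefl refl (≤-trans (two-at-zero f fi fj) c))
  where
  two-at-zero : ∀ {n} (f : Fin (suc n) → Bool) {j} → f fz ≡ true → f (fs j) ≡ true → 2 ≤ count f
  two-at-zero f fz≡t fj rewrite fz≡t = s≤s (count-pos (λ k → f (fs k)) fj)
count≤1⇒unique f c {fs i} {fz}   fi fj = sym (count≤1⇒unique f c fj fi)
count≤1⇒unique f c {fs i} {fs j} fi fj =
  cong fs (count≤1⇒unique (λ k → f (fs k)) (≤-trans (m≤n+m _ _) c) fi fj)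

unique⇒count≤1 : ∀ {n} (f : Fin n → Bool) →
  (∀ {i j} → f i ≡ true → f j ≡ true → i ≡ j) → count f ≤ 1
unique⇒count≤1 {zero}  f u = z≤n
unique⇒count≤1 {suc n} f u with f fz in e
... | true  = ≤-reflexive (cong suc (count-false (λ i → f (fs i)) rest-false))
  where
  rest-false : ∀ i → f (fs i) ≡ false
  rest-false i with f (fs i) in ei
  ... | false = refl
  ... | true  with () ← u e ei
... | false = unique⇒count≤1 (λ i → f (fs i)) (λ fi fj → FP.suc-injective (u fi fj))

count-∨+count-∧ : ∀ {n} (f g : Fin n → Bool) →
  count (λ i → f i ∨ g i) + count (λ i → f i ∧ g i) ≡ count f + count g
count-∨+count-∧ {zero}  f g = refl
count-∨+count-∧ {suc n} f g with f fz | g fz | count-∨+count-∧ (λ i → f (fs i)) (λ i → g (fs i))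
... | true  | true  | ih = cong suc (trans (+-suc _ _) (trans (cong suc ih) (sym (+-suc _ _))))
... | true  | false | ih = cong suc ih
... | false | true  | ih = trans (cong suc ih) (sym (+-suc _ _))
... | false | false | ih = ih

count-eqB : ∀ {n} (a : Fin n) → count (λ i → eqB i a) ≡ 1
count-eqB a = ≤-antisym
  (unique⇒count≤1 (λ i → eqB i a) (λ i≡a j≡a → trans (eqB-true i≡a) (sym (eqB-true j≡a))))
  (count-pos (λ i → eqB i a) (eqB-refl a))

count≡sum : ∀ {n} (f : Fin n → Bool) → count f ≡ sum (λ i → if f i then 1 else 0)
count≡sum {zero}  f = refl
count≡sum {suc n} f = cong ((if f fz then 1 else 0) +_) (count≡sum (λ i → f (fs i)))

sumF≡sum : ∀ {n} (f : Fin n → ℕ) → sumF f ≡ sum f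
sumF≡sum {zero}  f = refl
sumF≡sum {suc n} f = cong (f fz +_) (sumF≡sum (λ i → f (fs i)))

edgeCount≡sum : ∀ {n} (H : BGraph n) → edgeCount H ≡ sum (λ u → count (H u))
edgeCount≡sum H = sumF≡sum (λ u → count (H u))

sum-mono : ∀ {n} {f g : Fin n → ℕ} → (∀ i → f i ≤ g i) → sum f ≤ sum g
sum-mono {zero}  h = z≤n
sum-mono {suc n} h = +-mono-≤ (h fz) (sum-mono (λ i → h (fs i)))

edgeCount-mono : ∀ {n} {F G : BGraph n} → (∀ x y → F x y ≡ true → G x y ≡ true) →
  edgeCount F ≤ edgeCount G
edgeCount-mono {F = F} {G} h = begin
  edgeCount F             ≡⟨ edgeCount≡sum F ⟩
  sum (λ u → count (F u)) ≤⟨ sum-mono (λ u → count-mono (h u)) ⟩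
  sum (λ u → count (G u)) ≡⟨ edgeCount≡sum G ⟨
  edgeCount G             ∎
  where open ≤-Reasoning

edgeCount-∨+edgeCount-∧ : ∀ {n} (F G : BGraph n) →
  edgeCount (λ x y → F x y ∨ G x y) + edgeCount (λ x y → F x y ∧ G x y) ≡ edgeCount F + edgeCount G
edgeCount-∨+edgeCount-∧ F G = begin
  edgeCount (λ x y → F x y ∨ G x y) + edgeCount (λ x y → F x y ∧ G x y)
    ≡⟨ cong₂ _+_ (edgeCount≡sum (λ x y → F x y ∨ G x y)) (edgeCount≡sum (λ x y → F x y ∧ G x y)) ⟩
  sum (λ x → count (λ y → F x y ∨ G x y)) + sum (λ x → count (λ y → F x y ∧ G x y))
    ≡⟨ ∑-distrib-+ (λ x → count (λ y → F x y ∨ G x y)) (λ x → count (λ y → F x y ∧ G x y)) ⟨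
  sum (λ x → count (λ y → F x y ∨ G x y) + count (λ y → F x y ∧ G x y))
    ≡⟨ sum-cong-≗ (λ x → count-∨+count-∧ (F x) (G x)) ⟩
  sum (λ x → count (F x) + count (G x))
    ≡⟨ ∑-distrib-+ (λ x → count (F x)) (λ x → count (G x)) ⟩
  sum (λ x → count (F x)) + sum (λ x → count (G x))
    ≡⟨ cong₂ _+_ (edgeCount≡sum F) (edgeCount≡sum G) ⟨
  edgeCount F + edgeCount G ∎
  where open ≡-Reasoning

edgeCount-∨ : ∀ {n} (F G : BGraph n) → edgeCount (λ x y → F x y ∨ G x y) ≤ edgeCount F + edgeCount G
edgeCount-∨ F G = m+n≤o⇒m≤o _ (≤-reflexive (edgeCount-∨+edgeCount-∧ F G))

edgeCount-empty : ∀ {n} → edgeCount {n} (λ _ _ → false) ≡ 0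
edgeCount-empty {n} = begin
  edgeCount {n} (λ _ _ → false)         ≡⟨ edgeCount≡sum {n} (λ _ _ → false) ⟩
  sum (λ (x : Fin n) → count {n} (λ _ → false))
                                        ≡⟨ sum-cong-≗ {n} (λ _ → count-false {n} (λ _ → false) (λ _ → refl)) ⟩
  sum {n} (λ _ → 0)                     ≡⟨ sum-replicate-zero n ⟩
  0                                     ∎
  where open ≡-Reasoning

edgeCount-∨-disjoint : ∀ {n} (F G : BGraph n) → (∀ x y → F x y ≡ true → G x y ≡ false) →
  edgeCount (λ x y → F x y ∨ G x y) ≡ edgeCount F + edgeCount G
edgeCount-∨-disjoint {n} F G disj = begin
  edgeCount (λ x y → F x y ∨ G x y)     ≡⟨ +-identityʳ _ ⟨
  edgeCount (λ x y → F x y ∨ G x y) + 0 ≡⟨ cong (edgeCount (λ x y → F x y ∨ G x y) +_) none ⟨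
  edgeCount (λ x y → F x y ∨ G x y) + edgeCount (λ x y → F x y ∧ G x y)
                                        ≡⟨ edgeCount-∨+edgeCount-∧ F G ⟩
  edgeCount F + edgeCount G             ∎
  where
  open ≡-Reasoning
  none : edgeCount (λ x y → F x y ∧ G x y) ≡ 0
  none = n≤0⇒n≡0 (≤-trans (edgeCount-mono both-false) (≤-reflexive (edgeCount-empty {n})))
    where
    both-false : ∀ x y → F x y ∧ G x y ≡ true → false ≡ true
    both-false x y e with ∧-true {F x y} e
    ... | f , g = trans (sym (disj x y f)) g

edgeCount-single : ∀ {n} (a b : Fin n) → edgeCount (λ x y → eqB x a ∧ eqB y b) ≡ 1
edgeCount-single a b = begin
  edgeCount (λ x y → eqB x a ∧ eqB y b)             ≡⟨ edgeCount≡sum (λ x y → eqB x a ∧ eqB y b) ⟩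
  sum (λ x → count (λ y → eqB x a ∧ eqB y b))       ≡⟨ sum-cong-≗ row ⟩
  sum (λ x → if eqB x a then 1 else 0)              ≡⟨ count≡sum (λ x → eqB x a) ⟨
  count (λ x → eqB x a)                             ≡⟨ count-eqB a ⟩
  1                                                 ∎
  where
  open ≡-Reasoning
  row : ∀ x → count (λ y → eqB x a ∧ eqB y b) ≡ (if eqB x a then 1 else 0)
  row x with eqB x a
  ... | true  = count-eqB b
  ... | false = count-false (λ y → false ∧ eqB y b) (λ _ → refl)

edgeCount-flip : ∀ {n} (F : BGraph n) → edgeCount (flip F) ≡ edgeCount F
edgeCount-flip F = begin
  edgeCount (flip F)                                 ≡⟨ edgeCount≡sum (flip F) ⟩
  sum (λ y → count (λ x → F x y))                    ≡⟨ sum-cong-≗ (λ y → count≡sum (flip F y)) ⟩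
  sum (λ y → sum (λ x → if F x y then 1 else 0))     ≡⟨ ∑-comm (λ x y → if F x y then 1 else 0) ⟨
  sum (λ x → sum (λ y → if F x y then 1 else 0))     ≡⟨ sum-cong-≗ (λ x → count≡sum (F x)) ⟨
  sum (λ x → count (F x))                            ≡⟨ edgeCount≡sum F ⟨
  edgeCount F                                        ∎
  where open ≡-Reasoning

module _ {A : Set} where

  lookup-injective : ∀ {xs : List A} → Unique xs → ∀ {i j} → lookup xs i ≡ lookup xs j → i ≡ j
  lookup-injective {_ ∷ _}  u       {fz}   {fz}   _ = refl
  lookup-injective {_ ∷ xs} u       {fz}   {fs j} e = ⊥-elim (Unique[x∷xs]⇒x∉xs u (subst (_∈ xs) (sym e) (∈-lookup j)))
  lookup-injective {_ ∷ xs} u       {fs i} {fz}   e = ⊥-elim (Unique[x∷xs]⇒x∉xs u (subst (_∈ xs) e (∈-lookup i)))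
  lookup-injective {_ ∷ _}  (_ ∷ u) {fs i} {fs j} e = cong fs (lookup-injective u e)

  unique-length≤ : ∀ {m} {xs : List A} (f : A → Fin m) → Unique xs →
    (∀ {x y} → x ∈ xs → y ∈ xs → f x ≡ f y → x ≡ y) → length xs ≤ m
  unique-length≤ {m} {xs} f u f-inj with length xs ≤? m
  ... | yes ok = ok
  ... | no ¬ok with i , j , i<j , fi≡fj ← FP.pigeonhole (≰⇒> ¬ok) (f ∘ lookup xs) =
    ⊥-elim (FP.<-irrefl (lookup-injective u (f-inj (∈-lookup i) (∈-lookup j) fi≡fj)) i<j)

module _ {n : ℕ} where

  linkTo : Fin n → List (Fin n) → BGraph n
  linkTo a []      _ _ = false
  linkTo a (b ∷ _) x y = eqB x a ∧ eqB y b

  pathGraph : List (Fin n) → BGraph n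
  pathGraph []      _ _ = false
  pathGraph (a ∷ l) x y = linkTo a l x y ∨ pathGraph l x y

  position : List (Fin n) → Fin n → ℕ
  position []      _ = 0
  position (a ∷ l) x = if eqB x a then 0 else suc (position l x)

lastOf : ∀ {A : Set} → A → List A → A
lastOf x []       = x
lastOf _ (y ∷ ys) = lastOf y ys

module _ {n : ℕ} where

  linkTo-true : ∀ {a : Fin n} l {x y} → linkTo a l x y ≡ true → x ≡ a × Σ _ λ r → l ≡ y ∷ r
  linkTo-true (b ∷ r) e with x≡a , y≡b ← ∧-true e = eqB-true x≡a , r , cong (_∷ r) (sym (eqB-true y≡b))

  pathGraph-∈ : ∀ (l : List (Fin n)) {x y} → pathGraph l x y ≡ true → x ∈ l × y ∈ l
  pathGraph-∈ (a ∷ l) e with ∨-true e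
  ... | inj₂ e′ = map there there (pathGraph-∈ l e′)
  ... | inj₁ e′ with linkTo-true l e′
  ...   | refl , _ , refl = here refl , there (here refl)

  pathGraph-target : ∀ {a : Fin n} l {x y} → pathGraph (a ∷ l) x y ≡ true → y ∈ l
  pathGraph-target l e with ∨-true e
  ... | inj₂ e′ = pathGraph-∈ l e′ .proj₂
  ... | inj₁ e′ with linkTo-true l e′
  ...   | _ , _ , refl = here refl

  pathGraph-link : ∀ (a b : Fin n) r → pathGraph (a ∷ b ∷ r) a b ≡ true
  pathGraph-link a b r rewrite eqB-refl a | eqB-refl b = refl

  last-or-succ : ∀ (h : Fin n) rest {x} → x ∈ h ∷ rest →
    x ≡ lastOf h rest ⊎ Σ _ λ y → pathGraph (h ∷ rest) x y ≡ true
  last-or-succ h []      (here x≡h)  = inj₁ x≡h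
  last-or-succ h (b ∷ r) (here refl) = inj₂ (b , pathGraph-link h b r)
  last-or-succ h (b ∷ r) {x} (there x∈) with last-or-succ b r x∈
  ... | inj₁ x≡last  = inj₁ x≡last
  ... | inj₂ (y , e) = inj₂ (y , ∨-trueʳ (linkTo h (b ∷ r) x y) e)

  head-or-pred : ∀ (h : Fin n) rest {y} → y ∈ h ∷ rest →
    y ≡ h ⊎ Σ _ λ x → pathGraph (h ∷ rest) x y ≡ true
  head-or-pred h rest    (here y≡h) = inj₁ y≡h
  head-or-pred h (b ∷ r) {y} (there y∈) with head-or-pred b r y∈
  ... | inj₁ refl    = inj₂ (h , pathGraph-link h b r)
  ... | inj₂ (x , e) = inj₂ (x , ∨-trueʳ (linkTo h (b ∷ r) x y) e)

  position-here : ∀ (a : Fin n) l → position (a ∷ l) a ≡ 0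
  position-here a l rewrite eqB-refl a = refl

  position-tail : ∀ {a x : Fin n} {l} → Unique (a ∷ l) → x ∈ l → position (a ∷ l) x ≡ suc (position l x)
  position-tail {a} {x} u x∈ rewrite eqB-false {x = x} {a} (λ { refl → Unique[x∷xs]⇒x∉xs u x∈ }) = refl

  position-succ : ∀ (l : List (Fin n)) {x y} → Unique l → pathGraph l x y ≡ true →
    position l y ≡ suc (position l x)
  position-succ (a ∷ l) {x} {y} u e with ∨-true e
  ... | inj₁ e′ with linkTo-true l e′
  ...   | refl , r , refl = begin
    position (a ∷ y ∷ r) y       ≡⟨ position-tail u (here refl) ⟩
    suc (position (y ∷ r) y)     ≡⟨ cong suc (position-here y r) ⟩
    1                            ≡⟨ cong suc (position-here a (y ∷ r)) ⟨
    suc (position (a ∷ y ∷ r) a) ∎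
    where open ≡-Reasoning
  position-succ (a ∷ l) {x} {y} u@(_ ∷ u′) e | inj₂ e′ with x∈ , y∈ ← pathGraph-∈ l e′ = begin
    position (a ∷ l) y       ≡⟨ position-tail u y∈ ⟩
    suc (position l y)       ≡⟨ cong suc (position-succ l u′ e′) ⟩
    suc (suc (position l x)) ≡⟨ cong suc (position-tail u x∈) ⟨
    suc (position (a ∷ l) x) ∎
    where open ≡-Reasoning

  position-injective : ∀ (l : List (Fin n)) {x y} → x ∈ l → y ∈ l →
    position l x ≡ position l y → x ≡ y
  position-injective (a ∷ l) {x} {y} x∈ y∈ e with x F.≟ a | y F.≟ a
  ... | yes refl | yes refl = refl
  ... | yes refl | no  _    = ⊥-elim (0≢1+n e)
  ... | no  _    | yes refl = ⊥-elim (0≢1+n (sym e))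
  ... | no  x≢a  | no  y≢a  = position-injective l (tail x∈ x≢a) (tail y∈ y≢a) (suc-injective e)
    where
    tail : ∀ {z} → z ∈ a ∷ l → z ≢ a → z ∈ l
    tail (here z≡a) z≢a = ⊥-elim (z≢a z≡a)
    tail (there z∈) _   = z∈

  edgeCount-pathGraph : ∀ (l : List (Fin n)) → edgeCount (pathGraph l) ≤ length l ∸ 1
  edgeCount-pathGraph []          = ≤-reflexive (edgeCount-empty {n})
  edgeCount-pathGraph (a ∷ [])    = ≤-reflexive (edgeCount-empty {n})
  edgeCount-pathGraph (a ∷ b ∷ r) = ≤-trans (edgeCount-∨ (linkTo a (b ∷ r)) (pathGraph (b ∷ r)))
    (+-mono-≤ (≤-reflexive (edgeCount-single a b)) (edgeCount-pathGraph (b ∷ r)))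

Walk-snoc : ∀ {n} {Q : BGraph n} {u v w m} → Walk Q u v m → Q v w ≡ true → Walk Q u w (suc m)
Walk-snoc nil         e = cons e nil
Walk-snoc (cons e′ w) e = cons e′ (Walk-snoc w e)

module _ {n : ℕ} {Q : BGraph n} where

  Walk-reverse : ∀ {u v m} → Walk Q u v m → Walk (flip Q) v u m
  Walk-reverse nil        = nil
  Walk-reverse (cons e w) = Walk-snoc (Walk-reverse w) e

  Walk-rank : (φ : Fin n → ℕ) → (∀ {x y} → Q x y ≡ true → φ y ≡ suc (φ x)) →
    ∀ {u v m} → Walk Q u v m → φ v ≡ m + φ u
  Walk-rank φ up nil                    = refl
  Walk-rank φ up (cons {u} {m = m} e w) = trans (Walk-rank φ up w) (trans (cong (m +_) (up e)) (+-suc m (φ u)))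

  rank⇒Acyclic : (φ : Fin n → ℕ) → (∀ {x y} → Q x y ≡ true → φ y ≡ suc (φ x)) → Acyclic Q
  rank⇒Acyclic φ up v m w = m≢1+n+m (φ v) (Walk-rank φ up w)

  Conn-trans : ∀ {u v w} → Conn Q u v → Conn Q v w → Conn Q u w
  Conn-trans here      c′ = c′
  Conn-trans (fwd e c) c′ = fwd e (Conn-trans c c′)
  Conn-trans (bwd e c) c′ = bwd e (Conn-trans c c′)

  Conn-sym : ∀ {u v} → Conn Q u v → Conn Q v u
  Conn-sym here      = here
  Conn-sym (fwd e c) = Conn-trans (Conn-sym c) (bwd e here)
  Conn-sym (bwd e c) = Conn-trans (Conn-sym c) (fwd e here)

  Conn-flip : ∀ {u v} → Conn Q u v → Conn (flip Q) u v
  Conn-flip here      = here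
  Conn-flip (fwd e c) = bwd e (Conn-flip c)
  Conn-flip (bwd e c) = fwd e (Conn-flip c)

  Stable : (Fin n → Set) → Set
  Stable P = (∀ {x y} → Q x y ≡ true → P x → P y) × (∀ {x y} → Q x y ≡ true → P y → P x)

  Conn-stable : ∀ {P} → Stable P → ∀ {u v} → Conn Q u v → P u → P v
  Conn-stable st here      p = p
  Conn-stable st (fwd e c) p = Conn-stable st c (proj₁ st e p)
  Conn-stable st (bwd e c) p = Conn-stable st c (proj₂ st e p)

Acyclic-flip : ∀ {n} {Q : BGraph n} → Acyclic Q → Acyclic (flip Q)
Acyclic-flip acyclic v m w = acyclic v m (Walk-reverse w)

module _ {n : ℕ} where

  SuccUnique : BGraph n → Set
  SuccUnique H = ∀ {u v w} → H u v ≡ true → H u w ≡ true → v ≡ w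

  PredUnique : BGraph n → Set
  PredUnique H = ∀ {u v w} → H u w ≡ true → H v w ≡ true → u ≡ v

  successor? : (H : BGraph n) → ∀ t → Dec (Σ (Fin n) λ y → H t y ≡ true)
  successor? H t = FP.any? (λ y → H t y Bool.≟ true)

  record IsPath (H : BGraph n) (l : List (Fin n)) : Set where
    field
      unique : Unique l
      edges  : ∀ {x y} → pathGraph l x y ≡ true → H x y ≡ true

open IsPath

module _ {n : ℕ} {H : BGraph n} where

  edge-from-path : SuccUnique H → ∀ {h rest} → IsPath H (h ∷ rest) → ∀ {x y} → H x y ≡ true →
    x ∈ h ∷ rest → x ≡ lastOf h rest ⊎ pathGraph (h ∷ rest) x y ≡ true
  edge-from-path succ-unique P e x∈ with last-or-succ _ _ x∈
  ... | inj₁ x≡last  = inj₁ x≡last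
  ... | inj₂ (_ , e′) with refl ← succ-unique e (edges P e′) = inj₂ e′

  edge-into-path : PredUnique H → ∀ {h rest} → IsPath H (h ∷ rest) → ∀ {x y} → H x y ≡ true →
    y ∈ h ∷ rest → y ≡ h ⊎ pathGraph (h ∷ rest) x y ≡ true
  edge-into-path pred-unique P e y∈ with head-or-pred _ _ y∈
  ... | inj₁ y≡h     = inj₁ y≡h
  ... | inj₂ (_ , e′) with refl ← pred-unique e (edges P e′) = inj₂ e′

  path-Conn : ∀ {h rest} → IsPath H (h ∷ rest) → ∀ {x} → x ∈ h ∷ rest → Conn H h x
  path-Conn {h} {rest}  P (here refl) = here
  path-Conn {h} {b ∷ r} P (there x∈)  = fwd (edges P (pathGraph-link h b r)) (path-Conn tail x∈)
    where
    tail : IsPath H (b ∷ r)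
    tail = record
      { unique = Unique.tail (unique P)
      ; edges  = λ {x} {y} e → edges P (∨-trueʳ (linkTo h (b ∷ r) x y) e)
      }

record BackPath {n} (H : BGraph n) (t : Fin n) : Set where
  constructor backPath
  field
    head   : Fin n
    rest   : List (Fin n)
    isPath : IsPath H (head ∷ rest)
    ends   : lastOf head rest ≡ t
    stops  : (∀ p → H p head ≡ false) ⊎ H t head ≡ true

module _ {n : ℕ} {H : BGraph n} (succ-unique : SuccUnique H) where

  private
    open DecMembership (FP._≟_ {n}) using (_∈?_)

    prepend : ∀ {p h rest} → IsPath H (h ∷ rest) → H p h ≡ true → p ∉ h ∷ rest →
      IsPath H (p ∷ h ∷ rest)
    prepend {p} {h} {rest} P e p∉ = record
      { unique = ¬Any⇒All¬ (h ∷ rest) p∉ ∷ unique P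
      ; edges  = λ {x} {y} e′ → new-or-old (∨-true {linkTo p (h ∷ rest) x y} e′)
      }
      where
      new-or-old : ∀ {x y} → linkTo p (h ∷ rest) x y ≡ true ⊎ pathGraph (h ∷ rest) x y ≡ true → H x y ≡ true
      new-or-old {x} {y} (inj₁ link) with refl , _ , refl ← linkTo-true {a = p} (h ∷ rest) {x} {y} link = e
      new-or-old (inj₂ old)  = edges P old

    pred-on-path-is-last : ∀ {p h rest} → IsPath H (h ∷ rest) → H p h ≡ true → p ∈ h ∷ rest →
      p ≡ lastOf h rest
    pred-on-path-is-last P e p∈ with edge-from-path succ-unique P e p∈
    ... | inj₁ p≡last = p≡last
    ... | inj₂ e′     = ⊥-elim (Unique[x∷xs]⇒x∉xs (unique P) (pathGraph-target _ e′))

    -- The fuel is never exhausted: a path in H has at most n vertices.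
    extend : ∀ fuel h rest → IsPath H (h ∷ rest) → n < length (h ∷ rest) + fuel →
      BackPath H (lastOf h rest)
    extend zero h rest P n<len = ⊥-elim (<⇒≱ (subst (n <_) (+-identityʳ _) n<len)
      (unique-length≤ (λ x → x) (unique P) (λ _ _ x≡y → x≡y)))
    extend (suc fuel) h rest P n<len with successor? (flip H) h
    ... | no none = backPath h rest P refl (inj₁ (λ p → ¬-not (λ e → none (p , e))))
    ... | yes (p , e) with p ∈? h ∷ rest
    ...   | yes p∈ = backPath h rest P refl (inj₂ (subst (λ z → H z h ≡ true) (pred-on-path-is-last P e p∈) e))
    ...   | no  p∉ = extend fuel p (h ∷ rest) (prepend P e p∉) (subst (n <_) (+-suc _ fuel) n<len)

  walkBack : ∀ t → BackPath H t
  walkBack t = extend n t [] (record { unique = [] ∷ [] ; edges = λ () }) (n<1+n n)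

-- cutPath c l deletes the edge leaving the i-th vertex of l exactly when countdown c i is 0,
-- and block c i numbers the resulting subpaths.
countdown : ℕ → ℕ → ℕ
countdown c       zero    = c
countdown zero    (suc i) = countdown 6 i
countdown (suc c) (suc i) = countdown c i

block : ℕ → ℕ → ℕ
block c       zero    = 0
block zero    (suc i) = suc (block 6 i)
block (suc c) (suc i) = block c i

countdown≤6 : ∀ {c} i → c ≤ 6 → countdown c i ≤ 6
countdown≤6         zero    c≤6 = c≤6
countdown≤6 {zero}  (suc i) _   = countdown≤6 i ≤-refl
countdown≤6 {suc c} (suc i) c≤6 = countdown≤6 i (<⇒≤ c≤6)

countdown-first-block : ∀ c i → block c i ≡ 0 → countdown c i ≤ c
countdown-first-block c       zero    _  = ≤-refl
countdown-first-block (suc c) (suc i) b≡0 = m≤n⇒m≤1+n (countdown-first-block c i b≡0)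

block-countdown-injective : ∀ c {i j} → block c i ≡ block c j → countdown c i ≡ countdown c j → i ≡ j
block-countdown-injective c       {zero}  {zero}  _ _ = refl
block-countdown-injective (suc c) {zero}  {suc j} b d =
  ⊥-elim (1+n≰n (≤-trans (≤-reflexive d) (countdown-first-block c j (sym b))))
block-countdown-injective (suc c) {suc i} {zero}  b d =
  ⊥-elim (1+n≰n (≤-trans (≤-reflexive (sym d)) (countdown-first-block c i b)))
block-countdown-injective zero    {suc i} {suc j} b d = cong suc (block-countdown-injective 6 (suc-injective b) d)
block-countdown-injective (suc c) {suc i} {suc j} b d = cong suc (block-countdown-injective c b d)

module _ {n : ℕ} where

  cutPath : ℕ → List (Fin n) → BGraph n
  cutPath c       []      _ _ = false
  cutPath zero    (_ ∷ l) x y = cutPath 6 l x y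
  cutPath (suc c) (a ∷ l) x y = linkTo a l x y ∨ cutPath c l x y

  cutPath-⊆ : ∀ c (l : List (Fin n)) {x y} → cutPath c l x y ≡ true → pathGraph l x y ≡ true
  cutPath-⊆ zero    (a ∷ l) {x} {y} e = ∨-trueʳ (linkTo a l x y) (cutPath-⊆ 6 l e)
  cutPath-⊆ (suc c) (a ∷ l) {x} {y} e with ∨-true e
  ... | inj₁ link = subst (λ z → z ∨ pathGraph l x y ≡ true) (sym link) refl
  ... | inj₂ cut  = ∨-trueʳ (linkTo a l x y) (cutPath-⊆ c l cut)

  cutPath-block : ∀ c (l : List (Fin n)) {x y} → Unique l → cutPath c l x y ≡ true →
    block c (position l x) ≡ block c (position l y)
  cutPath-block zero    (a ∷ l) u@(_ ∷ u′) e with x∈ , y∈ ← pathGraph-∈ l (cutPath-⊆ 6 l e)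
    rewrite position-tail u x∈ | position-tail u y∈ = cong suc (cutPath-block 6 l u′ e)
  cutPath-block (suc c) (a ∷ l) u e with ∨-true e
  cutPath-block (suc c) (a ∷ l) {y = y} u e | inj₁ link with refl , r , refl ← linkTo-true l link =
    trans (cong (block (suc c)) (position-here a l)) (cong (block (suc c)) (sym position-y))
    where
    position-y : position (a ∷ y ∷ r) y ≡ 1
    position-y = trans (position-tail u (here refl)) (cong suc (position-here y r))
  cutPath-block (suc c) (a ∷ l) u@(_ ∷ u′) e | inj₂ cut with x∈ , y∈ ← pathGraph-∈ l (cutPath-⊆ c l cut)
    rewrite position-tail u x∈ | position-tail u y∈ = cutPath-block c l u′ cut

  cutPath-components≤7 : ∀ {c} → c ≤ 6 → (l : List (Fin n)) → Unique l → ∀ {v} → v ∈ l →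
    (xs : List (Fin n)) → Unique xs → All (Conn (cutPath c l) v) xs → length xs ≤ 7
  cutPath-components≤7 {c} c≤6 l u {v} v∈ xs xs-unique conn =
    unique-length≤ residue xs-unique residue-injective
    where
    residue : Fin n → Fin 7
    residue x = F.fromℕ< (s≤s (countdown≤6 (position l x) c≤6))

    ∈l : ∀ {x} → x ∈ xs → x ∈ l
    ∈l x∈ = Conn-stable ((λ e _ → pathGraph-∈ l (cutPath-⊆ c l e) .proj₂) ,
                         (λ e _ → pathGraph-∈ l (cutPath-⊆ c l e) .proj₁))
                        (All.lookup conn x∈) v∈

    same-block : ∀ {x} → x ∈ xs → block c (position l x) ≡ block c (position l v)
    same-block x∈ = Conn-stable ((λ e b → trans (sym (cutPath-block c l u e)) b) ,
                                 (λ e b → trans (cutPath-block c l u e) b))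
                                (All.lookup conn x∈) refl

    residue-injective : ∀ {x y} → x ∈ xs → y ∈ xs → residue x ≡ residue y → x ≡ y
    residue-injective x∈ y∈ r≡ = position-injective l (∈l x∈) (∈l y∈)
      (block-countdown-injective c (trans (same-block x∈) (sym (same-block y∈)))
        (FP.fromℕ<-injective _ _ _ _ r≡))

keptEdges : ℕ → ℕ → ℕ
keptEdges c       zero          = 0
keptEdges zero    (suc L)       = keptEdges 6 L
keptEdges (suc c) (suc zero)    = 0
keptEdges (suc c) (suc (suc L)) = suc (keptEdges c (suc L))

edgeCount-cutPath : ∀ {n} c (l : List (Fin n)) → Unique l → edgeCount (cutPath c l) ≡ keptEdges c (length l)
edgeCount-cutPath {n} c       []          _            = edgeCount-empty {n}
edgeCount-cutPath     zero    (a ∷ l)     (_ ∷ u)      = edgeCount-cutPath 6 l u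
edgeCount-cutPath {n} (suc c) (a ∷ [])    _            = edgeCount-empty {n}
edgeCount-cutPath     (suc c) (a ∷ b ∷ r) u@(_ ∷ u′) = begin
  edgeCount (cutPath (suc c) (a ∷ b ∷ r))
    ≡⟨ edgeCount-∨-disjoint (linkTo a (b ∷ r)) (cutPath c (b ∷ r)) disjoint ⟩
  edgeCount (linkTo a (b ∷ r)) + edgeCount (cutPath c (b ∷ r))
    ≡⟨ cong₂ _+_ (edgeCount-single a b) (edgeCount-cutPath c (b ∷ r) u′) ⟩
  suc (keptEdges c (suc (length r)))
    ∎
  where
  open ≡-Reasoning
  disjoint : ∀ x y → linkTo a (b ∷ r) x y ≡ true → cutPath c (b ∷ r) x y ≡ false
  disjoint x y link = ¬-not λ cut → Unique[x∷xs]⇒x∉xs u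
    (subst (_∈ b ∷ r) (linkTo-true (b ∷ r) link .proj₁) (pathGraph-∈ (b ∷ r) (cutPath-⊆ c (b ∷ r) cut) .proj₁))

-- With c edges left before the next cut, 2 ∸ c bounds how far 3 · kept can fall behind 2 · edges.
keptEdges-bound : ∀ c L → 2 * (L ∸ 1) ≤ 3 * keptEdges c L + (2 ∸ c)
keptEdges-bound c       zero          = z≤n
keptEdges-bound c       (suc zero)    = z≤n
keptEdges-bound zero    (suc (suc L)) = begin
  2 * suc L                         ≡⟨ *-suc 2 L ⟩
  2 + 2 * L                         ≤⟨ +-monoʳ-≤ 2 (keptEdges-bound 6 (suc L)) ⟩
  2 + (3 * keptEdges 6 (suc L) + 0) ≡⟨ rearrange (keptEdges 6 (suc L)) ⟩
  3 * keptEdges 6 (suc L) + 2       ∎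
  where
  open ≤-Reasoning
  rearrange : ∀ k → 2 + (3 * k + 0) ≡ 3 * k + 2
  rearrange = solve-∀
keptEdges-bound (suc c) (suc (suc L)) = begin
  2 * suc L                 ≡⟨ *-suc 2 L ⟩
  2 + 2 * L                 ≤⟨ +-monoʳ-≤ 2 (keptEdges-bound c (suc L)) ⟩
  2 + (3 * k + (2 ∸ c))     ≤⟨ +-monoʳ-≤ 2 (+-monoʳ-≤ (3 * k) (deficit-step c)) ⟩
  2 + (3 * k + suc (1 ∸ c)) ≡⟨ rearrange k (1 ∸ c) ⟩
  3 * suc k + (1 ∸ c)       ∎
  where
  open ≤-Reasoning
  k = keptEdges c (suc L)
  deficit-step : ∀ c → 2 ∸ c ≤ suc (1 ∸ c)
  deficit-step zero          = ≤-refl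
  deficit-step (suc zero)    = ≤-refl
  deficit-step (suc (suc c)) = ≤-trans (≤-reflexive (0∸n≡0 c)) z≤n
  rearrange : ∀ k d → 2 + (3 * k + suc d) ≡ 3 * suc k + d
  rearrange = solve-∀

keptEdges-path : ∀ L → 2 * (L ∸ 1) ≤ 3 * keptEdges 6 L
keptEdges-path L = ≤-trans (keptEdges-bound 6 L) (≤-reflexive (+-identityʳ _))

keptEdges-cycle : ∀ L → 3 ≤ L → 2 * L ≤ 3 * keptEdges 6 L
keptEdges-cycle (suc zero)          (s≤s ())
keptEdges-cycle (suc (suc zero))    (s≤s (s≤s ()))
keptEdges-cycle (suc (suc (suc m))) _ = begin
  2 * (3 + m)                       ≡⟨ *-distribˡ-+ 2 3 m ⟩
  6 + 2 * m                         ≤⟨ +-monoʳ-≤ 6 (keptEdges-bound 4 (suc m)) ⟩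
  6 + (3 * keptEdges 4 (suc m) + 0) ≡⟨ rearrange (keptEdges 4 (suc m)) ⟩
  3 * (2 + keptEdges 4 (suc m))     ∎
  where
  open ≤-Reasoning
  rearrange : ∀ k → 6 + (3 * k + 0) ≡ 3 * (2 + k)
  rearrange = solve-∀

edgesIn-true : ∀ {n} {H : BGraph n} {D x y} → edgesIn H D x y ≡ true →
  H x y ≡ true × D x ≡ true × D y ≡ true
edgesIn-true {H = H} {D} {x} {y} e with Hxy , Dxy ← ∧-true {H x y} e = Hxy , ∧-true {D x} Dxy

edgesIn-intro : ∀ {n} {H : BGraph n} {D x y} → H x y ≡ true → D x ≡ true → D y ≡ true →
  edgesIn H D x y ≡ true
edgesIn-intro {H = H} {D} {x} {y} Hxy Dx Dy rewrite Hxy | Dx | Dy = refl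

record DensePartition {n} (H : BGraph n) (D : Fin n → Bool) (P : BGraph n) : Set where
  field
    ⊆edgesIn     : ∀ {u v} → P u v ≡ true → edgesIn H D u v ≡ true
    acyclic      : Acyclic P
    components≤7 : ∀ {v} → D v ≡ true → (xs : List (Fin n)) → Unique xs → All (Conn P v) xs →
                   length xs ≤ 7
    dense        : 2 * edgeCount (edgesIn H D) ≤ 3 * edgeCount P

open DensePartition

DensePartition-flip : ∀ {n} {H P : BGraph n} {D} → DensePartition H D P →
  DensePartition (flip H) D (flip P)
DensePartition-flip {H = H} {P} {D} dp = record
  { ⊆edgesIn     = λ {u} {v} e → trans (edgesIn-flip u v) (⊆edgesIn dp e)
  ; acyclic      = Acyclic-flip (acyclic dp)
  ; components≤7 = λ Dv xs u conn → components≤7 dp Dv xs u (All.map Conn-flip conn)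
  ; dense        = begin
      2 * edgeCount (edgesIn (flip H) D)   ≤⟨ *-monoʳ-≤ 2 (edgeCount-mono (λ x y → trans (sym (edgesIn-flip x y)))) ⟩
      2 * edgeCount (flip (edgesIn H D))   ≡⟨ cong (2 *_) (edgeCount-flip (edgesIn H D)) ⟩
      2 * edgeCount (edgesIn H D)          ≤⟨ dense dp ⟩
      3 * edgeCount P                      ≡⟨ cong (3 *_) (edgeCount-flip P) ⟨
      3 * edgeCount (flip P)               ∎
  }
  where
  open ≤-Reasoning
  edgesIn-flip : ∀ x y → edgesIn (flip H) D x y ≡ edgesIn H D y x
  edgesIn-flip x y = cong (H y x ∧_) (Bool.∧-comm (D x) (D y))

last-∈ : ∀ {A : Set} (h : A) rest → lastOf h rest ∈ h ∷ rest
last-∈ h []      = here refl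
last-∈ h (b ∷ r) = there (last-∈ b r)

module _ {n : ℕ} {H : BGraph n} (succ-unique : SuccUnique H) (pred-unique : PredUnique H)
         {h rest} (P : IsPath H (h ∷ rest)) where

  path-edges : (∀ y → H (lastOf h rest) y ≡ false) →
    ∀ {x y} → H x y ≡ true → x ∈ h ∷ rest → pathGraph (h ∷ rest) x y ≡ true
  path-edges sink e x∈ with edge-from-path succ-unique P e x∈
  ... | inj₁ refl = ⊥-elim (true≢false (trans (sym e) (sink _)))
  ... | inj₂ e′   = e′

  path-stable : (∀ y → H (lastOf h rest) y ≡ false) → (∀ x → H x h ≡ false) →
    Stable {Q = H} (_∈ h ∷ rest)
  path-stable sink source = (λ e x∈ → pathGraph-∈ _ (path-edges sink e x∈) .proj₂) , back
    where
    back : ∀ {x y} → H x y ≡ true → y ∈ h ∷ rest → x ∈ h ∷ rest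
    back e y∈ with edge-into-path pred-unique P e y∈
    ... | inj₁ refl = ⊥-elim (true≢false (trans (sym e) (source _)))
    ... | inj₂ e′   = pathGraph-∈ _ e′ .proj₁

  cycle-edges : H (lastOf h rest) h ≡ true → ∀ {x y} → H x y ≡ true → x ∈ h ∷ rest →
    pathGraph (h ∷ rest) x y ≡ true ⊎ (x ≡ lastOf h rest × y ≡ h)
  cycle-edges closing e x∈ with edge-from-path succ-unique P e x∈
  ... | inj₁ refl = inj₂ (refl , succ-unique e closing)
  ... | inj₂ e′   = inj₁ e′

  cycle-stable : H (lastOf h rest) h ≡ true → Stable {Q = H} (_∈ h ∷ rest)
  cycle-stable closing = forth , back
    where
    forth : ∀ {x y} → H x y ≡ true → x ∈ h ∷ rest → y ∈ h ∷ rest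
    forth e x∈ with cycle-edges closing e x∈
    ... | inj₁ e′         = pathGraph-∈ _ e′ .proj₂
    ... | inj₂ (_ , refl) = here refl
    back : ∀ {x y} → H x y ≡ true → y ∈ h ∷ rest → x ∈ h ∷ rest
    back e y∈ with edge-into-path pred-unique P e y∈
    ... | inj₁ refl = subst (_∈ h ∷ rest) (pred-unique closing e) (last-∈ h rest)
    ... | inj₂ e′   = pathGraph-∈ _ e′ .proj₁

module _ {n : ℕ} {H : BGraph n} (succ-unique : SuccUnique H) (pred-unique : PredUnique H)
         {D : Fin n → Bool} (component : IsComponent H D) where

  private
    connected : ∀ {u v} → D u ≡ true → D v ≡ true → Conn H u v
    connected Du = component .proj₂ _ _ Du .proj₁

    closed : ∀ {u v} → D u ≡ true → Conn H u v → D v ≡ true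
    closed Du = component .proj₂ _ _ Du .proj₂

    head-in-component : ∀ {h rest} → IsPath H (h ∷ rest) → D (lastOf h rest) ≡ true → D h ≡ true
    head-in-component P Dt = closed Dt (Conn-sym (path-Conn P (last-∈ _ _)))

  module _ {h rest} (P : IsPath H (h ∷ rest)) (Dh : D h ≡ true) where

    path-⊆-component : ∀ {x} → x ∈ h ∷ rest → D x ≡ true
    path-⊆-component x∈ = closed Dh (path-Conn P x∈)

    component-⊆-path : Stable {Q = H} (_∈ h ∷ rest) → ∀ {x} → D x ≡ true → x ∈ h ∷ rest
    component-⊆-path st Dx = Conn-stable st (connected Dh Dx) (here refl)

    cutPath-partition : Stable {Q = H} (_∈ h ∷ rest) →
      2 * edgeCount (edgesIn H D) ≤ 3 * edgeCount (cutPath 6 (h ∷ rest)) →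
      DensePartition H D (cutPath 6 (h ∷ rest))
    cutPath-partition st density = record
      { ⊆edgesIn     = λ {x} {y} e → let x∈ , y∈ = pathGraph-∈ l (cutPath-⊆ 6 l e) in
          edgesIn-intro {H = H} {D} (edges P (cutPath-⊆ 6 l e)) (path-⊆-component x∈) (path-⊆-component y∈)
      ; acyclic      = rank⇒Acyclic (position l) (λ e → position-succ l (unique P) (cutPath-⊆ 6 l e))
      ; components≤7 = λ Dv → cutPath-components≤7 ≤-refl l (unique P) (component-⊆-path st Dv)
      ; dense        = density
      }
      where l = h ∷ rest

  path-partition : ∀ {t} → D t ≡ true → (∀ y → H t y ≡ false) → Σ (BGraph n) (DensePartition H D)
  path-partition {t} Dt sink with walkBack succ-unique t
  ... | backPath h rest P refl (inj₂ closing) = ⊥-elim (true≢false (trans (sym closing) (sink h)))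
  ... | backPath h rest P refl (inj₁ source)  =
    cutPath 6 l , cutPath-partition P Dh (path-stable succ-unique pred-unique P sink source) density
    where
    l  = h ∷ rest
    Dh = head-in-component P Dt

    density : 2 * edgeCount (edgesIn H D) ≤ 3 * edgeCount (cutPath 6 l)
    density = begin
      2 * edgeCount (edgesIn H D) ≤⟨ *-monoʳ-≤ 2 (edgeCount-mono on-path) ⟩
      2 * edgeCount (pathGraph l) ≤⟨ *-monoʳ-≤ 2 (edgeCount-pathGraph l) ⟩
      2 * (length l ∸ 1)          ≤⟨ keptEdges-path (length l) ⟩
      3 * keptEdges 6 (length l)  ≡⟨ cong (3 *_) (edgeCount-cutPath 6 l (unique P)) ⟨
      3 * edgeCount (cutPath 6 l) ∎
      where
      open ≤-Reasoning
      on-path : ∀ x y → edgesIn H D x y ≡ true → pathGraph l x y ≡ true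
      on-path x y e = let Hxy , Dx , _ = edgesIn-true {H = H} {D} e in
        path-edges succ-unique pred-unique P sink Hxy (component-⊆-path P Dh (path-stable succ-unique pred-unique P sink source) Dx)

  cycle-length≥3 : (∀ x → H x x ≡ false) → ¬ Is2Cycle H D → ∀ {h rest} → IsPath H (h ∷ rest) →
    D h ≡ true → H (lastOf h rest) h ≡ true → (∀ {x} → D x ≡ true → x ∈ h ∷ rest) →
    3 ≤ length (h ∷ rest)
  cycle-length≥3 irreflexive _ {h} {[]} _ _ closing _ =
    ⊥-elim (true≢false (trans (sym closing) (irreflexive h)))
  cycle-length≥3 _ not-2-cycle {h} {b ∷ []} P Dh closing ⊆path = ⊥-elim (not-2-cycle
    ( h , b , (λ h≡b → Unique[x∷xs]⇒x∉xs (unique P) (here h≡b))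
    , Dh , path-⊆-component P Dh (there (here refl))
    , edges P (pathGraph-link h b []) , closing , only ))
    where
    only : ∀ v → D v ≡ true → v ≡ h ⊎ v ≡ b
    only v Dv with ⊆path Dv
    ... | here v≡h         = inj₁ v≡h
    ... | there (here v≡b) = inj₂ v≡b
  cycle-length≥3 _ _ {rest = _ ∷ _ ∷ _} _ _ _ _ = s≤s (s≤s (s≤s z≤n))

  cycle-partition : (∀ x → H x x ≡ false) → ¬ Is2Cycle H D → ∀ {t} → D t ≡ true →
    (∀ x → D x ≡ true → Σ (Fin n) λ p → H p x ≡ true) → Σ (BGraph n) (DensePartition H D)
  cycle-partition irreflexive not-2-cycle {t} Dt has-pred with walkBack succ-unique t
  ... | backPath h rest P refl (inj₁ source)  =
    let p , e = has-pred h (head-in-component P Dt) in ⊥-elim (true≢false (trans (sym e) (source p)))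
  ... | backPath h rest P refl (inj₂ closing) =
    cutPath 6 l , cutPath-partition P Dh (cycle-stable succ-unique pred-unique P closing) density
    where
    l  = h ∷ rest
    Dh = head-in-component P Dt

    closing-edge : BGraph n
    closing-edge x y = eqB x t ∧ eqB y h

    density : 2 * edgeCount (edgesIn H D) ≤ 3 * edgeCount (cutPath 6 l)
    density = begin
      2 * edgeCount (edgesIn H D)
        ≤⟨ *-monoʳ-≤ 2 (edgeCount-mono on-cycle) ⟩
      2 * edgeCount (λ x y → pathGraph l x y ∨ closing-edge x y)
        ≤⟨ *-monoʳ-≤ 2 (edgeCount-∨ (pathGraph l) closing-edge) ⟩
      2 * (edgeCount (pathGraph l) + edgeCount closing-edge)
        ≤⟨ *-monoʳ-≤ 2 (+-mono-≤ (edgeCount-pathGraph l) (≤-reflexive (edgeCount-single t h))) ⟩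
      2 * (length rest + 1)
        ≡⟨ cong (2 *_) (+-comm (length rest) 1) ⟩
      2 * length l
        ≤⟨ keptEdges-cycle (length l) (cycle-length≥3 irreflexive not-2-cycle P Dh closing ⊆path) ⟩
      3 * keptEdges 6 (length l)
        ≡⟨ cong (3 *_) (edgeCount-cutPath 6 l (unique P)) ⟨
      3 * edgeCount (cutPath 6 l)
        ∎
      where
      open ≤-Reasoning
      ⊆path : ∀ {x} → D x ≡ true → x ∈ l
      ⊆path = component-⊆-path P Dh (cycle-stable succ-unique pred-unique P closing)
      on-cycle : ∀ x y → edgesIn H D x y ≡ true → pathGraph l x y ∨ closing-edge x y ≡ true
      on-cycle x y e with Hxy , Dx , _ ← edgesIn-true {H = H} {D} e | cycle-edges succ-unique pred-unique P closing Hxy (⊆path Dx)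
      ... | inj₁ e′            = subst (λ z → z ∨ closing-edge x y ≡ true) (sym e′) refl
      ... | inj₂ (refl , refl) = ∨-trueʳ (pathGraph l x y)
        (subst₂ (λ a b → a ∧ b ≡ true) (sym (eqB-refl x)) (sym (eqB-refl y)) refl)

component-partition : ∀ {n} {H : BGraph n} → SuccUnique H → PredUnique H → (∀ x → H x x ≡ false) →
  ∀ {D} → IsComponent H D → ¬ Is2Cycle H D → Σ (BGraph n) (DensePartition H D)
component-partition {n} {H} succ-unique pred-unique irreflexive {D} component not-2-cycle
  with FP.any? (λ t → (D t Bool.≟ true) ×-dec ¬? (successor? H t))
... | yes (t , Dt , no-succ) =
  path-partition succ-unique pred-unique component Dt (λ y → ¬-not (λ e → no-succ (y , e)))
... | no no-sink =
  -- D has no sink: every vertex has a successor in H, i.e. a predecessor in flip H.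
  let P , dp = cycle-partition (λ e e′ → pred-unique e e′) (λ e e′ → succ-unique e e′) flip-component
                 irreflexive flip-not-2-cycle (component .proj₁ .proj₂) has-succ
  in flip P , DensePartition-flip dp
  where
  flip-component : IsComponent (flip H) D
  flip-component = component .proj₁ , λ u v Du →
    (λ Dv → Conn-flip (component .proj₂ u v Du .proj₁ Dv)) , (λ c → component .proj₂ u v Du .proj₂ (Conn-flip c))
  flip-not-2-cycle : ¬ Is2Cycle (flip H) D
  flip-not-2-cycle (a , b , a≢b , Da , Db , Hba , Hab , only) = not-2-cycle (a , b , a≢b , Da , Db , Hab , Hba , only)
  has-succ : ∀ x → D x ≡ true → Σ (Fin n) λ y → H x y ≡ true
  has-succ x Dx with successor? H x
  ... | yes s  = s
  ... | no  ns = ⊥-elim (no-sink (x , Dx , ns))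

record IsPathCycleSubgraph {n} (G C : BGraph n) : Set where
  field
    ⊆G          : ∀ {u v} → C u v ≡ true → G u v ≡ true
    succ-unique : SuccUnique C
    pred-unique : PredUnique C

module _ {n : ℕ} {G C : BGraph n} where

  IsPCC⇒IsPathCycleSubgraph : IsPCC (Edge G) C → IsPathCycleSubgraph G C
  IsPCC⇒IsPathCycleSubgraph (⊆G , out≤1 , in≤1) = record
    { ⊆G          = ⊆G _ _
    ; succ-unique = λ {u} → count≤1⇒unique (C u) (out≤1 u)
    ; pred-unique = λ {_} {_} {w} → count≤1⇒unique (λ x → C x w) (in≤1 w)
    }

  DensePartition⇒KPathPartition : ∀ {k D P} → 7 ≤ k → IsPathCycleSubgraph G C → DensePartition C D P →
    (∀ u v → P u v ≡ true → edgesIn C D u v ≡ true) × IsKPathPartition k G D P ×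
    2 * edgeCount (edgesIn C D) ≤ 3 * edgeCount P
  DensePartition⇒KPathPartition {k} {D} {P} 7≤k sub dp =
    (λ _ _ → ⊆edgesIn dp) ,
    ( (λ _ _ e → let Cuv , Du , Dv = ⊆C e in ⊆G sub Cuv , Du , Dv)
    , (λ v → unique⇒count≤1 (P v) (λ e e′ → succ-unique sub (⊆C e .proj₁) (⊆C e′ .proj₁)))
    , (λ v → unique⇒count≤1 (λ u → P u v) (λ e e′ → pred-unique sub (⊆C e .proj₁) (⊆C e′ .proj₁)))
    , acyclic dp
    , (λ v Dv xs u conn → ≤-trans (components≤7 dp Dv xs u conn) 7≤k) ) ,
    dense dp
    where
    open IsPathCycleSubgraph
    ⊆C : ∀ {u v} → P u v ≡ true → C u v ≡ true × D u ≡ true × D v ≡ true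
    ⊆C e = edgesIn-true {H = C} {D} (⊆edgesIn dp e)

removed-edge-true : ∀ {n} (C : BGraph n) {a b x y} →
  (if eqB x a ∧ eqB y b then false else C x y) ≡ true → C x y ≡ true × ¬ (x ≡ a × y ≡ b)
removed-edge-true C {a} {b} {x} {y} e with eqB x a in x≟a | eqB y b in y≟b
... | true  | false = e , λ (_ , y≡b) → eqB-false⇒≢ y≟b y≡b
... | false | _     = e , λ (x≡a , _) → eqB-false⇒≢ x≟a x≡a

upd-true : ∀ {n} (C : BGraph n) {a b u v x y} → upd C a b u v x y ≡ true →
  (x ≡ u × y ≡ v) ⊎ (C x y ≡ true × ¬ (x ≡ a × y ≡ b))
upd-true C {a} {b} {u} {v} {x} {y} e with eqB x u in x≟u | eqB y v in y≟v
... | true  | true  = inj₁ (eqB-true x≟u , eqB-true y≟v)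
... | true  | false = inj₂ (removed-edge-true C {a} {b} e)
... | false | _     = inj₂ (removed-edge-true C {a} {b} e)

module _ {n : ℕ} {G C C′ : BGraph n} (sub : IsPathCycleSubgraph G C) where

  open IsPathCycleSubgraph sub

  replace-edge : ∀ {a b u v} → G u v ≡ true →
    (∀ {x y} → C′ x y ≡ true → (x ≡ u × y ≡ v) ⊎ (C x y ≡ true × ¬ (x ≡ a × y ≡ b))) →
    (∀ {y} → C u y ≡ true → u ≡ a × y ≡ b) → (∀ {x} → C x v ≡ true → x ≡ a × v ≡ b) →
    IsPathCycleSubgraph G C′
  replace-edge {a} {b} {u} {v} Guv new-or-old u-out v-in = record
    { ⊆G          = λ e → [ (λ { (refl , refl) → Guv }) , (λ (Cxy , _) → ⊆G Cxy) ]′ (new-or-old e)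
    ; succ-unique = λ e e′ → unique-succ (new-or-old e) (new-or-old e′)
    ; pred-unique = λ e e′ → unique-pred (new-or-old e) (new-or-old e′)
    }
    where
    unique-succ : ∀ {x y z} → (x ≡ u × y ≡ v) ⊎ (C x y ≡ true × ¬ (x ≡ a × y ≡ b)) →
      (x ≡ u × z ≡ v) ⊎ (C x z ≡ true × ¬ (x ≡ a × z ≡ b)) → y ≡ z
    unique-succ (inj₁ (_ , refl))    (inj₁ (_ , refl))    = refl
    unique-succ (inj₁ (refl , _))    (inj₂ (Cuz , fresh)) = ⊥-elim (fresh (u-out Cuz))
    unique-succ (inj₂ (Cuy , fresh)) (inj₁ (refl , _))    = ⊥-elim (fresh (u-out Cuy))
    unique-succ (inj₂ (Cxy , _))     (inj₂ (Cxz , _))     = succ-unique Cxy Cxz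

    unique-pred : ∀ {x w y} → (x ≡ u × y ≡ v) ⊎ (C x y ≡ true × ¬ (x ≡ a × y ≡ b)) →
      (w ≡ u × y ≡ v) ⊎ (C w y ≡ true × ¬ (w ≡ a × y ≡ b)) → x ≡ w
    unique-pred (inj₁ (refl , _))    (inj₁ (refl , _))    = refl
    unique-pred (inj₁ (_ , refl))    (inj₂ (Cwv , fresh)) = ⊥-elim (fresh (v-in Cwv))
    unique-pred (inj₂ (Cxv , fresh)) (inj₁ (_ , refl))    = ⊥-elim (fresh (v-in Cxv))
    unique-pred (inj₂ (Cxy , _))     (inj₂ (Cwy , _))     = pred-unique Cxy Cwy

  StepC-preserves : StepC G C C′ → IsPathCycleSubgraph G C′
  StepC-preserves (u , v , Guv , _ , inj₁ (out≡0 , _ , w , Cwv , C′≡)) =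
    replace-edge Guv (λ {x} {y} e → upd-true C (trans (sym (C′≡ x y)) e))
      (λ Cuy → ⊥-elim (true≢false (trans (sym Cuy) (count≡0⇒false (C u) out≡0 _))))
      (λ Cxv → pred-unique Cxv Cwv , refl)
  StepC-preserves (u , v , Guv , _ , inj₂ (in≡0 , _ , w , Cuw , C′≡)) =
    replace-edge Guv (λ {x} {y} e → upd-true C (trans (sym (C′≡ x y)) e))
      (λ Cuy → refl , succ-unique Cuy Cuw)
      (λ Cxv → ⊥-elim (true≢false (trans (sym Cxv) (count≡0⇒false (λ x → C x v) in≡0 _))))

Star-StepC-preserves : ∀ {n} {G C C′ : BGraph n} → Star (StepC G) C C′ →
  IsPathCycleSubgraph G C → IsPathCycleSubgraph G C′
Star-StepC-preserves ε        sub = sub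
Star-StepC-preserves (s ◅ ss) sub = Star-StepC-preserves ss (StepC-preserves sub s)

IsConstructedC⇒IsPathCycleSubgraph : ∀ {n} {G C : BGraph n} → IsConstructedC G C → IsPathCycleSubgraph G C
IsConstructedC⇒IsPathCycleSubgraph ((_ , (pcc , _) , steps) , _) =
  Star-StepC-preserves steps (IsPCC⇒IsPathCycleSubgraph pcc)

lemma3 : (n k : ℕ) → 7 ≤ k →
    (G : BGraph n) → Irrefl G →
    (C : BGraph n) → IsConstructedC G C →
    (M : BGraph n) → IsConstructedM G C M →
    (D : Fin n → Bool) → IsComponent C D →
    IsolatedInG3 C M D → ¬ Is2Cycle C D →
    Σ (BGraph n) λ P →
      (∀ u v → P u v ≡ true → edgesIn C D u v ≡ true) ×
      IsKPathPartition k G D P ×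
      2 * edgeCount (edgesIn C D) ≤ 3 * edgeCount P
lemma3 n k 7≤k G G-irreflexive C constructed _ _ D component _ not-2-cycle =
  let P , dp = component-partition succ-unique pred-unique C-irreflexive component not-2-cycle
  in P , DensePartition⇒KPathPartition 7≤k sub dp
  where
  sub = IsConstructedC⇒IsPathCycleSubgraph constructed
  open IsPathCycleSubgraph sub
  C-irreflexive : ∀ x → C x x ≡ false
  C-irreflexive x = ¬-not (λ Cxx → true≢false (trans (sym (⊆G Cxx)) (G-irreflexive x)))
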